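{- Let $n>5$ be an integer, and let $\alpha_n$ (resp. $\beta_n$) be the maximum (resp. minimum) of $\det(G)$ over all simple graphs $G$ with $n$ vertices. If $G$ and $H$ are simple graphs with $n$ vertices such that $\det(G)=\alpha_n$ or $\det(H)=\beta_n$, then (the corresponding) $G$ and $H$ do not contain exactly one cycle.
   Context: For a finite simple graph $G$, $\det(G)$ denotes the determinant of an adjacency matrix of $G$. A graph "has a unique cycle" if it contains exactly one cycle. -}

module Defs where

open import Data.Nat using (ℕ; zero; suc)
open import Data.Fin using (Fin; zero; suc; toℕ; punchIn; inject₁; fromℕ)
open import Data.Bool using (Bool; true; false)
open import Data.Integer using (ℤ; +_; -_; _+_; _*_)
open import Data.Product using (Σ; _×_; _,_)
open import Data.Sum using (_⊎_)
open import Relation.Binary.PropositionalEquality using (_≡_)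
open import Relation.Nullary using (¬_)
open import Function.Definitions using (Injective)

record SimpleGraph (n : ℕ) : Set where
  field
    adj   : Fin n → Fin n → Bool
    symm  : ∀ u v → adj u v ≡ adj v u
    loopless : ∀ v → adj v v ≡ false

open SimpleGraph public

Adj : ∀ {n} → SimpleGraph n → Fin n → Fin n → Set
Adj G u v = adj G u v ≡ true

sumFin : ∀ n → (Fin n → ℤ) → ℤ
sumFin zero    f = + 0
sumFin (suc n) f = f zero + sumFin n (λ i → f (suc i))

sign : ℕ → ℤ
sign zero          = + 1
sign (suc zero)    = - (+ 1)
sign (suc (suc k)) = sign k

det : ∀ n → (Fin n → Fin n → ℤ) → ℤ
det zero    M = + 1
det (suc n) M =
  sumFin (suc n) (λ j → sign (toℕ j) * (M zero j * det n (λ r c → M (suc r) (punchIn j c))))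

boolToℤ : Bool → ℤ
boolToℤ true  = + 1
boolToℤ false = + 0

adjMatrix : ∀ {n} → SimpleGraph n → Fin n → Fin n → ℤ
adjMatrix G u v = boolToℤ (adj G u v)

detG : ∀ {n} → SimpleGraph n → ℤ
detG {n} G = det n (adjMatrix G)

-- A cycle in G: distinct vertices v₀, …, v_{m-1} (m = 3 + len ≥ 3) with
-- v_i ~ v_{i+1} and v_{m-1} ~ v₀.
record Cycle {n : ℕ} (G : SimpleGraph n) : Set where
  field
    len   : ℕ
    vert  : Fin (suc (suc (suc len))) → Fin n
    inj   : Injective _≡_ _≡_ vert
    path  : ∀ (i : Fin (suc (suc len))) → Adj G (vert (inject₁ i)) (vert (suc i))
    close : Adj G (vert (fromℕ (suc (suc len)))) (vert zero)

open Cycle public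

CycleEdge : ∀ {n} {G : SimpleGraph n} → Cycle G → Fin n → Fin n → Set
CycleEdge C u v =
  Σ (Fin (suc (suc (len C)))) (λ i →
      (u ≡ vert C (inject₁ i) × v ≡ vert C (suc i))
    ⊎ (v ≡ vert C (inject₁ i) × u ≡ vert C (suc i)))
  ⊎ ((u ≡ vert C (fromℕ (suc (suc (len C)))) × v ≡ vert C zero)
    ⊎ (v ≡ vert C (fromℕ (suc (suc (len C)))) × u ≡ vert C zero))

-- Two cycles are the same cycle (subgraph) iff they have the same edge set.
SameCycle : ∀ {n} {G : SimpleGraph n} → Cycle G → Cycle G → Set
SameCycle C D = ∀ u v → (CycleEdge C u v → CycleEdge D u v) × (CycleEdge D u v → CycleEdge C u v)

HasUniqueCycle : ∀ {n} → SimpleGraph n → Set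
HasUniqueCycle G = Σ (Cycle G) (λ C → ∀ (D : Cycle G) → SameCycle C D)

module Submission where

-- The proof compares two facts.
--  * Unicyclic graphs have |det| ≤ 4.  Deleting an edge uv of the cycle leaves
--    an acyclic graph, whose adjacency matrix B is totally unimodular: every
--    square submatrix with distinct rows and columns has determinant 0 or ±1
--    (such a submatrix has a row or column with at most one nonzero entry, or
--    an alternating row/column walk produces a cycle).  The adjacency matrix
--    of G is B with unit vectors added to rows u and v, so by additivity in
--    these rows det G is a sum of four determinants of totally unimodular
--    matrices.
--  * For every n ≥ 6 there are graphs with det ≥ 5 and with det ≤ -5: explicit
--    graphs on 6 and 7 vertices, and adding a disjoint edge negates det.

open import Defs
open import Data.Nat as ℕ using (ℕ; zero; suc; z≤n; s≤s; _<_; _≡ᵇ_)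
import Data.Nat.Properties as ℕP
open import Data.Fin using (Fin; zero; suc; toℕ; punchIn; punchOut; inject₁; fromℕ; fromℕ<)
open import Data.Fin.Properties
  using (suc-injective; punchIn-injective; punchInᵢ≢i; punchIn-punchOut; any?; all?; pigeonhole;
         toℕ-fromℕ<; toℕ-inject₁; toℕ-fromℕ; toℕ-injective; toℕ<n)
  renaming (_≟_ to _≟ᶠ_)
open import Data.Bool using (Bool; true; false; _∧_; _∨_)
import Data.Bool.Properties as BoolP
open import Data.List using (List; []; _∷_)
open import Data.Integer using (ℤ; +_; -_; -[1+_]; _+_; _*_; _-_; ∣_∣; _≤_; +≤+; -≤-)
import Data.Integer.Properties as ℤP
open ℤP using (+-identityˡ; +-identityʳ; +-inverseˡ; *-identityˡ; *-zeroʳ; *-assoc;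
               *-distribˡ-+; neg-distrib-+; neg-distribˡ-*; abs-*)
open import Data.Integer.Solver using (module +-*-Solver)
open +-*-Solver using (solve; _:+_; _:*_; :-_; _:-_; _:=_; con)
open import Data.Product using (Σ; _×_; _,_; proj₁; proj₂)
open import Data.Sum using (_⊎_; inj₁; inj₂)
open import Data.Empty using (⊥-elim)
open import Function using (_∘_)
open import Function.Definitions using (Injective)
open import Relation.Binary using (tri<; tri≈; tri>)
open import Relation.Binary.PropositionalEquality
open import Relation.Nullary using (¬_; Dec; yes; no; ¬?; _×-dec_; _⊎-dec_)
open import Relation.Nullary.Decidable using (True; toWitness)
open import Relation.Unary using (Decidable)

0ℤ : ℤ
0ℤ = + 0

sumFin-cong : ∀ n {f g : Fin n → ℤ} → (∀ i → f i ≡ g i) → sumFin n f ≡ sumFin n g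
sumFin-cong zero    e = refl
sumFin-cong (suc n) e = cong₂ _+_ (e zero) (sumFin-cong n (λ i → e (suc i)))

sumFin-zero : ∀ n {f : Fin n → ℤ} → (∀ i → f i ≡ 0ℤ) → sumFin n f ≡ 0ℤ
sumFin-zero n e = trans (sumFin-cong n e) (zeros n)
  where
  zeros : ∀ n → sumFin n (λ _ → 0ℤ) ≡ 0ℤ
  zeros zero    = refl
  zeros (suc n) = trans (+-identityˡ _) (zeros n)

sumFin-+ : ∀ n (f g : Fin n → ℤ) → sumFin n (λ i → f i + g i) ≡ sumFin n f + sumFin n g
sumFin-+ zero    f g = refl
sumFin-+ (suc n) f g =
  trans (cong (_+_ (f zero + g zero)) (sumFin-+ n (λ i → f (suc i)) (λ i → g (suc i))))
        (solve 4 (λ a b c d → (a :+ b) :+ (c :+ d) := (a :+ c) :+ (b :+ d)) refl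
               (f zero) (g zero) (sumFin n (λ i → f (suc i))) (sumFin n (λ i → g (suc i))))

sumFin-neg : ∀ n (f : Fin n → ℤ) → sumFin n (λ i → - f i) ≡ - sumFin n f
sumFin-neg zero    f = refl
sumFin-neg (suc n) f =
  trans (cong (_+_ (- f zero)) (sumFin-neg n (λ i → f (suc i)))) (sym (neg-distrib-+ (f zero) _))

sumFin-- : ∀ n (f g : Fin n → ℤ) → sumFin n (λ i → f i - g i) ≡ sumFin n f - sumFin n g
sumFin-- n f g = trans (sumFin-+ n f (λ i → - g i)) (cong (_+_ (sumFin n f)) (sumFin-neg n g))

sumFin-scale : ∀ n c (f : Fin n → ℤ) → sumFin n (λ i → c * f i) ≡ c * sumFin n f
sumFin-scale zero    c f = sym (*-zeroʳ c)
sumFin-scale (suc n) c f =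
  trans (cong (_+_ (c * f zero)) (sumFin-scale n c (λ i → f (suc i)))) (sym (*-distribˡ-+ c (f zero) _))

sumFin-single : ∀ n (i₀ : Fin n) {f : Fin n → ℤ} → (∀ i → i ≢ i₀ → f i ≡ 0ℤ) → sumFin n f ≡ f i₀
sumFin-single (suc n) zero     {f} e =
  trans (cong (_+_ (f zero)) (sumFin-zero n (λ i → e (suc i) λ ()))) (+-identityʳ (f zero))
sumFin-single (suc n) (suc i₀) {f} e =
  trans (cong₂ _+_ (e zero λ ()) (sumFin-single n i₀ (λ i ne → e (suc i) (ne ∘ suc-injective))))
        (+-identityˡ _)

sumFin-punchIn : ∀ n (a : Fin (suc n)) (f : Fin (suc n) → ℤ) →
                 sumFin (suc n) f ≡ f a + sumFin n (λ b → f (punchIn a b))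
sumFin-punchIn n       zero    f = refl
sumFin-punchIn (suc n) (suc a) f =
  trans (cong (_+_ (f zero)) (sumFin-punchIn n a (λ i → f (suc i))))
        (solve 3 (λ x y z → x :+ (y :+ z) := y :+ (x :+ z)) refl (f zero) (f (suc a)) _)

sumFin-comm : ∀ m n (f : Fin m → Fin n → ℤ) →
              sumFin m (λ a → sumFin n (f a)) ≡ sumFin n (λ b → sumFin m (λ a → f a b))
sumFin-comm zero    n f = sym (sumFin-zero n (λ _ → refl))
sumFin-comm (suc m) n f =
  trans (cong (_+_ (sumFin n (f zero))) (sumFin-comm m n (λ a → f (suc a))))
        (sym (sumFin-+ n (f zero) (λ b → sumFin m (λ a → f (suc a) b))))

sgn : ∀ {k} → Fin k → ℤ
sgn i = sign (toℕ i)

sign-suc : ∀ m → sign (suc m) ≡ - sign m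
sign-suc zero          = refl
sign-suc (suc zero)    = refl
sign-suc (suc (suc m)) = sign-suc m

sign-square : ∀ m → sign m * sign m ≡ + 1
sign-square zero          = refl
sign-square (suc zero)    = refl
sign-square (suc (suc m)) = sign-square m

sign-cancel : ∀ m x → sign m * (sign m * x) ≡ x
sign-cancel m x = begin
  sign m * (sign m * x)   ≡⟨ sym (*-assoc (sign m) (sign m) x) ⟩
  sign m * sign m * x     ≡⟨ cong (_* x) (sign-square m) ⟩
  + 1 * x                 ≡⟨ *-identityˡ x ⟩
  x                       ∎
  where open ≡-Reasoning

∣sign*∣ : ∀ m x → ∣ sign m * x ∣ ≡ ∣ x ∣
∣sign*∣ m x = trans (abs-* (sign m) x) (trans (cong (ℕ._* ∣ x ∣) (∣sign∣ m)) (ℕP.*-identityˡ ∣ x ∣))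
  where
  ∣sign∣ : ∀ m → ∣ sign m ∣ ≡ 1
  ∣sign∣ zero          = refl
  ∣sign∣ (suc zero)    = refl
  ∣sign∣ (suc (suc m)) = ∣sign∣ m

Mat : ℕ → Set
Mat n = Fin n → Fin n → ℤ

minor : ∀ {n} → Fin (suc n) → Fin (suc n) → Mat (suc n) → Mat n
minor i j M r c = M (punchIn i r) (punchIn j c)

cofactor : ∀ n → Mat (suc n) → Fin (suc n) → ℤ
cofactor n M j = sgn j * (M zero j * det n (minor zero j M))

det-cong : ∀ n {M N : Mat n} → (∀ i j → M i j ≡ N i j) → det n M ≡ det n N
det-cong zero    e = refl
det-cong (suc n) e = sumFin-cong (suc n) λ j →
  cong₂ (λ x y → sgn j * (x * y)) (e zero j) (det-cong n (λ r c → e (suc r) (punchIn j c)))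

det-row-additive : ∀ n (i : Fin n) (M N P : Mat n) →
  (∀ r j → r ≢ i → P r j ≡ M r j) → (∀ r j → r ≢ i → N r j ≡ M r j) →
  (∀ j → P i j ≡ M i j + N i j) → det n P ≡ det n M + det n N
det-row-additive (suc n) zero M N P offP offN rowᵢ =
  trans (sumFin-cong (suc n) term) (sumFin-+ (suc n) (cofactor n M) (cofactor n N))
  where
  term : ∀ j → cofactor n P j ≡ cofactor n M j + cofactor n N j
  term j
    rewrite rowᵢ j
          | det-cong n {minor zero j P} {minor zero j M} (λ r c → offP (suc r) (punchIn j c) λ ())
          | det-cong n {minor zero j N} {minor zero j M} (λ r c → offN (suc r) (punchIn j c) λ ())
    = solve 4 (λ s a b x → s :* ((a :+ b) :* x) := s :* (a :* x) :+ s :* (b :* x)) refl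
              (sgn j) (M zero j) (N zero j) (det n (minor zero j M))
det-row-additive (suc n) (suc i) M N P offP offN rowᵢ =
  trans (sumFin-cong (suc n) term) (sumFin-+ (suc n) (cofactor n M) (cofactor n N))
  where
  term : ∀ j → cofactor n P j ≡ cofactor n M j + cofactor n N j
  term j
    rewrite offP zero j (λ ()) | offN zero j (λ ())
          | det-row-additive n i (minor zero j M) (minor zero j N) (minor zero j P)
              (λ r c ne → offP (suc r) (punchIn j c) (ne ∘ suc-injective))
              (λ r c ne → offN (suc r) (punchIn j c) (ne ∘ suc-injective))
              (λ c → rowᵢ (punchIn j c))
    = solve 4 (λ s a x y → s :* (a :* (x :+ y)) := s :* (a :* x) :+ s :* (a :* y)) refl
              (sgn j) (M zero j) (det n (minor zero j M)) (det n (minor zero j N))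

det-zero-column : ∀ n (j : Fin n) (M : Mat n) → (∀ r → M r j ≡ 0ℤ) → det n M ≡ 0ℤ
det-zero-column (suc n) j M zeroⱼ = sumFin-zero (suc n) term
  where
  term : ∀ j′ → cofactor n M j′ ≡ 0ℤ
  term j′ with j′ ≟ᶠ j
  ... | yes refl rewrite zeroⱼ zero = *-zeroʳ (sgn j′)
  ... | no j′≢j
    rewrite det-zero-column n (punchOut j′≢j) (minor zero j′ M)
              (λ r → trans (cong (M (suc r)) (punchIn-punchOut j′≢j)) (zeroⱼ (suc r)))
          | *-zeroʳ (M zero j′)
    = *-zeroʳ (sgn j′)

-- Expanding along the
-- first two rows writes det N as a sum over ordered pairs (a , c) of distinct
-- columns; the pair (a , c) of N and the pair (c , a) of the swapped matrix
-- contribute opposite terms.  To index the second expansion by the column c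
-- itself we use a total version of punchOut.

punchOut′ : ∀ {n} → Fin (suc (suc n)) → Fin (suc (suc n)) → Fin (suc n)
punchOut′         zero    zero    = zero
punchOut′         zero    (suc c) = c
punchOut′         (suc a) zero    = zero
punchOut′ {zero}  (suc a) (suc c) = zero
punchOut′ {suc n} (suc a) (suc c) = suc (punchOut′ a c)

punchOut′-punchIn : ∀ {n} (a : Fin (suc (suc n))) (b : Fin (suc n)) → punchOut′ a (punchIn a b) ≡ b
punchOut′-punchIn         zero    b       = refl
punchOut′-punchIn         (suc a) zero    = refl
punchOut′-punchIn {suc n} (suc a) (suc b) = cong suc (punchOut′-punchIn a b)

punchIn-punchOut′ : ∀ {n} (a c : Fin (suc (suc n))) → a ≢ c → punchIn a (punchOut′ a c) ≡ c
punchIn-punchOut′         zero       zero       a≢c = ⊥-elim (a≢c refl)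
punchIn-punchOut′         zero       (suc c)    a≢c = refl
punchIn-punchOut′         (suc a)    zero       a≢c = refl
punchIn-punchOut′ {zero}  (suc zero) (suc zero) a≢c = ⊥-elim (a≢c refl)
punchIn-punchOut′ {suc n} (suc a)    (suc c)    a≢c = cong suc (punchIn-punchOut′ a c (a≢c ∘ cong suc))

-- Deleting a and then c is the same as deleting c and then a.
punchIn-exchange : ∀ {n} (a c : Fin (suc (suc n))) → a ≢ c → ∀ (x : Fin n) →
  punchIn a (punchIn (punchOut′ a c) x) ≡ punchIn c (punchIn (punchOut′ c a) x)
punchIn-exchange         zero    zero    a≢c x       = ⊥-elim (a≢c refl)
punchIn-exchange {suc n} zero    (suc c) a≢c x       = refl
punchIn-exchange {suc n} (suc a) zero    a≢c x       = refl
punchIn-exchange {suc n} (suc a) (suc c) a≢c zero    = refl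
punchIn-exchange {suc n} (suc a) (suc c) a≢c (suc x) = cong suc (punchIn-exchange a c (a≢c ∘ cong suc) x)

sign-exchange : ∀ {n} (a c : Fin (suc (suc n))) → a ≢ c →
  sgn a * sgn (punchOut′ a c) ≡ - (sgn c * sgn (punchOut′ c a))
sign-exchange zero (suc c) _ rewrite sign-suc (toℕ c) =
  solve 2 (λ x o → o :* x := :- ((:- x) :* o)) refl (sgn c) (+ 1)
sign-exchange (suc a) zero _ rewrite sign-suc (toℕ a) =
  solve 2 (λ x o → (:- x) :* o := :- (o :* x)) refl (sgn a) (+ 1)
sign-exchange         zero       zero       a≢c = ⊥-elim (a≢c refl)
sign-exchange {zero}  (suc zero) (suc zero) a≢c = ⊥-elim (a≢c refl)
sign-exchange {suc n} (suc a)    (suc c)    a≢c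
  rewrite sign-suc (toℕ a) | sign-suc (toℕ c)
        | sign-suc (toℕ (punchOut′ a c)) | sign-suc (toℕ (punchOut′ c a))
  = trans (solve 2 (λ x y → (:- x) :* (:- y) := x :* y) refl (sgn a) (sgn (punchOut′ a c)))
   (trans (sign-exchange a c (a≢c ∘ cong suc))
          (solve 2 (λ z w → :- (z :* w) := :- ((:- z) :* (:- w))) refl (sgn c) (sgn (punchOut′ c a))))

-- Expansion along the first two rows: column a is used in row 0 and column
-- c ≢ a in row 1.  The diagonal terms (c ≡ a) are subtracted again, so the
-- second sum may range over all columns.
module TwoRowExpansion (n : ℕ) (N : Mat (suc (suc n))) where

  remaining : Fin (suc (suc n)) → Fin (suc n) → ℤ
  remaining a b = det n (λ r c → N (suc (suc r)) (punchIn a (punchIn b c)))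

  term : Fin (suc (suc n)) → Fin (suc (suc n)) → ℤ
  term a c = sgn a * (N zero a * (sgn (punchOut′ a c) * (N (suc zero) c * remaining a (punchOut′ a c))))

  expansion : det (suc (suc n)) N ≡ sumFin (suc (suc n)) (λ a → sumFin (suc (suc n)) (term a) - term a a)
  expansion = sumFin-cong (suc (suc n)) row₀
    where
    row₀ : ∀ a → cofactor (suc n) N a ≡ sumFin (suc (suc n)) (term a) - term a a
    row₀ a = begin
      sgn a * (N zero a * sumFin (suc n) (λ b → sgn b * (N (suc zero) (punchIn a b) * remaining a b)))
        ≡⟨ cong (sgn a *_) (sym (sumFin-scale (suc n) (N zero a) (λ b → sgn b * (N (suc zero) (punchIn a b) * remaining a b)))) ⟩
      sgn a * sumFin (suc n) (λ b → N zero a * (sgn b * (N (suc zero) (punchIn a b) * remaining a b)))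
        ≡⟨ sym (sumFin-scale (suc n) (sgn a) (λ b → N zero a * (sgn b * (N (suc zero) (punchIn a b) * remaining a b)))) ⟩
      sumFin (suc n) (λ b → sgn a * (N zero a * (sgn b * (N (suc zero) (punchIn a b) * remaining a b))))
        ≡⟨ sumFin-cong (suc n) (λ b → cong (λ b′ → sgn a * (N zero a * (sgn b′ * (N (suc zero) (punchIn a b) * remaining a b′))))
                                          (sym (punchOut′-punchIn a b))) ⟩
      sumFin (suc n) (λ b → term a (punchIn a b))
        ≡⟨ solve 2 (λ x y → y := (x :+ y) :- x) refl (term a a) _ ⟩
      term a a + sumFin (suc n) (λ b → term a (punchIn a b)) - term a a
        ≡⟨ cong (_- term a a) (sym (sumFin-punchIn (suc n) a (term a))) ⟩
      sumFin (suc (suc n)) (term a) - term a a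
        ∎
      where open ≡-Reasoning

swap01 : ∀ {n} → Fin (suc (suc n)) → Fin (suc (suc n))
swap01 zero          = suc zero
swap01 (suc zero)    = zero
swap01 (suc (suc r)) = suc (suc r)

det-swap01 : ∀ n (N : Mat (suc (suc n))) → det (suc (suc n)) (λ r → N (swap01 r)) ≡ - det (suc (suc n)) N
det-swap01 n N = begin
  det K N′                  ≡⟨ trans E′.expansion (sumFin-- K (λ a → sumFin K (E′.term a)) (λ a → E′.term a a)) ⟩
  X′ - Δ′                   ≡⟨ solve 4 (λ X X′ Δ Δ′ → X′ :- Δ′ := (X :+ X′) :- Δ′ :- X) refl X X′ Δ Δ′ ⟩
  (X + X′) - Δ′ - X         ≡⟨ cong (λ t → t - Δ′ - X) cancellation ⟩
  (Δ + Δ′) - Δ′ - X         ≡⟨ solve 4 (λ X X′ Δ Δ′ → (Δ :+ Δ′) :- Δ′ :- X := :- (X :- Δ)) refl X X′ Δ Δ′ ⟩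
  - (X - Δ)                 ≡⟨ cong -_ (sym (trans E.expansion (sumFin-- K (λ a → sumFin K (E.term a)) (λ a → E.term a a)))) ⟩
  - det K N                 ∎
  where
  open ≡-Reasoning
  K : ℕ
  K = suc (suc n)
  N′ : Mat K
  N′ r = N (swap01 r)
  module E  = TwoRowExpansion n N
  module E′ = TwoRowExpansion n N′
  X X′ Δ Δ′ : ℤ
  X  = sumFin K (λ a → sumFin K (E.term a))
  X′ = sumFin K (λ a → sumFin K (E′.term a))
  Δ  = sumFin K (λ a → E.term a a)
  Δ′ = sumFin K (λ a → E′.term a a)

  paired : ∀ a c → c ≢ a → E.term a c + E′.term c a ≡ 0ℤ
  paired a c c≢a
    rewrite det-cong n {λ r x → N (suc (suc r)) (punchIn c (punchIn (punchOut′ c a) x))}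
                       {λ r x → N (suc (suc r)) (punchIn a (punchIn (punchOut′ a c) x))}
                       (λ r x → cong (N (suc (suc r))) (sym (punchIn-exchange a c (c≢a ∘ sym) x)))
    = trans (solve 7 (λ sa sp sc sq P Q d → sa :* (P :* (sp :* (Q :* d))) :+ sc :* (Q :* (sq :* (P :* d)))
                                           := (sa :* sp :+ sc :* sq) :* (P :* Q :* d)) refl
                     (sgn a) (sgn (punchOut′ a c)) (sgn c) (sgn (punchOut′ c a)) (N zero a) (N (suc zero) c) (E.remaining a (punchOut′ a c)))
            (trans (cong (λ t → (t + sgn c * sgn (punchOut′ c a)) * rest) (sign-exchange a c (c≢a ∘ sym)))
                   (cong (_* rest) (+-inverseˡ (sgn c * sgn (punchOut′ c a)))))
    where
    rest : ℤ
    rest = N zero a * N (suc zero) c * E.remaining a (punchOut′ a c)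

  cancellation : X + X′ ≡ Δ + Δ′
  cancellation = begin
    X + X′                                                   ≡⟨ cong (_+_ X) (sumFin-comm K K E′.term) ⟩
    X + sumFin K (λ a → sumFin K (λ c → E′.term c a))        ≡⟨ sym (sumFin-+ K (λ a → sumFin K (E.term a)) (λ a → sumFin K (λ c → E′.term c a))) ⟩
    sumFin K (λ a → sumFin K (E.term a) + sumFin K (λ c → E′.term c a))
      ≡⟨ sumFin-cong K (λ a → trans (sym (sumFin-+ K (E.term a) (λ c → E′.term c a))) (sumFin-single K a (paired a))) ⟩
    sumFin K (λ a → E.term a a + E′.term a a)                ≡⟨ sumFin-+ K (λ a → E.term a a) (λ a → E′.term a a) ⟩
    Δ + Δ′                                                   ∎

toFront : ∀ {k} → Fin (suc k) → Fin (suc k) → Fin (suc k)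
toFront i zero    = i
toFront i (suc r) = punchIn i r

liftPerm : ∀ {k} → (Fin k → Fin k) → Fin (suc k) → Fin (suc k)
liftPerm f zero    = zero
liftPerm f (suc r) = suc (f r)

det-liftPerm : ∀ k (M : Mat (suc k)) (f : Fin k → Fin k) (c : ℤ) →
  (∀ j → det k (λ r → minor zero j M (f r)) ≡ c * det k (minor zero j M)) →
  det (suc k) (λ r → M (liftPerm f r)) ≡ c * det (suc k) M
det-liftPerm k M f c scaled =
  trans (sumFin-cong (suc k) term) (sumFin-scale (suc k) c (cofactor k M))
  where
  term : ∀ j → sgn j * (M zero j * det k (λ r → minor zero j M (f r))) ≡ c * cofactor k M j
  term j rewrite scaled j =
    solve 4 (λ s a c d → s :* (a :* (c :* d)) := c :* (s :* (a :* d))) refl (sgn j) (M zero j) c _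

det-rowToFront : ∀ k (i : Fin (suc k)) (M : Mat (suc k)) → det (suc k) (λ r → M (toFront i r)) ≡ sgn i * det (suc k) M
det-rowToFront k zero M =
  trans (det-cong (suc k) {λ r → M (toFront zero r)} {M} λ { zero c → refl ; (suc r) c → refl })
        (sym (*-identityˡ _))
det-rowToFront (suc k) (suc i) M = begin
  det (suc (suc k)) (λ r → M (toFront (suc i) r))
    ≡⟨ det-cong (suc (suc k)) {λ r → M (toFront (suc i) r)} {λ r → M′ (swap01 r)}
                (λ { zero c → refl ; (suc zero) c → refl ; (suc (suc r)) c → refl }) ⟩
  det (suc (suc k)) (λ r → M′ (swap01 r))
    ≡⟨ det-swap01 k M′ ⟩
  - det (suc (suc k)) M′
    ≡⟨ cong -_ (det-liftPerm (suc k) M (toFront i) (sgn i) (λ j → det-rowToFront k i (minor zero j M))) ⟩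
  - (sgn i * det (suc (suc k)) M)
    ≡⟨ neg-distribˡ-* (sgn i) _ ⟩
  - sgn i * det (suc (suc k)) M
    ≡⟨ cong (_* det (suc (suc k)) M) (sym (sign-suc (toℕ i))) ⟩
  sgn (suc i) * det (suc (suc k)) M
    ∎
  where
  open ≡-Reasoning
  M′ : Mat (suc (suc k))
  M′ r = M (liftPerm (toFront i) r)

sign-rearrange : ∀ a p j j′ → p * p ≡ + 1 → j * j ≡ + 1 → a * p ≡ - (j * j′) → - j′ * p ≡ j * a
sign-rearrange a p j j′ pp jj ap = sym (begin
  j * a                   ≡⟨ solve 2 (λ j a → j :* a := j :* a :* con (+ 1)) refl j a ⟩
  j * a * + 1             ≡⟨ cong (j * a *_) (sym pp) ⟩
  j * a * (p * p)         ≡⟨ solve 3 (λ j a p → j :* a :* (p :* p) := j :* (a :* p) :* p) refl j a p ⟩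
  j * (a * p) * p         ≡⟨ cong (λ t → j * t * p) ap ⟩
  j * - (j * j′) * p      ≡⟨ solve 3 (λ j j′ p → j :* (:- (j :* j′)) :* p := :- ((j :* j) :* (j′ :* p))) refl j j′ p ⟩
  - (j * j * (j′ * p))    ≡⟨ cong (λ t → - (t * (j′ * p))) jj ⟩
  - (+ 1 * (j′ * p))      ≡⟨ solve 2 (λ j′ p → :- (con (+ 1) :* (j′ :* p)) := (:- j′) :* p) refl j′ p ⟩
  - j′ * p                ∎)
  where open ≡-Reasoning

toFront-punchIn : ∀ {k} (j₀ : Fin (suc (suc k))) (j′ : Fin (suc k)) (c : Fin (suc k)) →
  toFront j₀ (punchIn (suc j′) c) ≡ punchIn (punchIn j₀ j′) (toFront (punchOut′ (punchIn j₀ j′) j₀) c)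
toFront-punchIn j₀ j′ zero    = sym (punchIn-punchOut′ (punchIn j₀ j′) j₀ (punchInᵢ≢i j₀ j′))
toFront-punchIn j₀ j′ (suc c) =
  sym (trans (punchIn-exchange (punchIn j₀ j′) j₀ (punchInᵢ≢i j₀ j′) c)
             (cong (λ z → punchIn j₀ (punchIn z c)) (punchOut′-punchIn j₀ j′)))

det-colToFront : ∀ k (j₀ : Fin (suc k)) (M : Mat (suc k)) → det (suc k) (λ r c → M r (toFront j₀ c)) ≡ sgn j₀ * det (suc k) M
det-colToFront zero    zero M = trans (det-cong 1 {λ r c → M r (toFront zero c)} {M} (λ { r zero → refl })) (sym (*-identityˡ _))
det-colToFront (suc k) j₀ M = begin
  det (suc (suc k)) (λ r c → M r (toFront j₀ c))
    ≡⟨ cong₂ _+_ first (sumFin-cong (suc k) term) ⟩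
  sgn j₀ * cofactor (suc k) M j₀ + sumFin (suc k) (λ j′ → sgn j₀ * cofactor (suc k) M (punchIn j₀ j′))
    ≡⟨ cong (_+_ (sgn j₀ * cofactor (suc k) M j₀)) (sumFin-scale (suc k) (sgn j₀) (λ j′ → cofactor (suc k) M (punchIn j₀ j′))) ⟩
  sgn j₀ * cofactor (suc k) M j₀ + sgn j₀ * sumFin (suc k) (λ j′ → cofactor (suc k) M (punchIn j₀ j′))
    ≡⟨ sym (*-distribˡ-+ (sgn j₀) _ _) ⟩
  sgn j₀ * (cofactor (suc k) M j₀ + sumFin (suc k) (λ j′ → cofactor (suc k) M (punchIn j₀ j′)))
    ≡⟨ cong (sgn j₀ *_) (sym (sumFin-punchIn (suc k) j₀ (cofactor (suc k) M))) ⟩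
  sgn j₀ * det (suc (suc k)) M
    ∎
  where
  open ≡-Reasoning
  first : + 1 * (M zero j₀ * det (suc k) (minor zero j₀ M)) ≡ sgn j₀ * cofactor (suc k) M j₀
  first = trans (*-identityˡ _) (sym (sign-cancel (toℕ j₀) _))
  term : ∀ j′ → sgn (suc j′) * (M zero (punchIn j₀ j′) * det (suc k) (λ r c → M (suc r) (toFront j₀ (punchIn (suc j′) c))))
              ≡ sgn j₀ * cofactor (suc k) M (punchIn j₀ j′)
  term j′ =
    let a = punchIn j₀ j′ ; p = punchOut′ a j₀ ; d = det (suc k) (minor zero a M) in begin
    sgn (suc j′) * (M zero a * det (suc k) (λ r c → M (suc r) (toFront j₀ (punchIn (suc j′) c))))
      ≡⟨ cong (λ t → sgn (suc j′) * (M zero a * t))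
              (trans (det-cong (suc k) (λ r c → cong (M (suc r)) (toFront-punchIn j₀ j′ c)))
                     (det-colToFront k p (minor zero a M))) ⟩
    sgn (suc j′) * (M zero a * (sgn p * d))
      ≡⟨ solve 4 (λ x y z w → x :* (z :* (y :* w)) := (x :* y) :* (z :* w)) refl (sgn (suc j′)) (sgn p) (M zero a) d ⟩
    sgn (suc j′) * sgn p * (M zero a * d)
      ≡⟨ cong (λ t → t * sgn p * (M zero a * d)) (sign-suc (toℕ j′)) ⟩
    - sgn j′ * sgn p * (M zero a * d)
      ≡⟨ cong (_* (M zero a * d))
              (sign-rearrange (sgn a) (sgn p) (sgn j₀) (sgn j′) (sign-square (toℕ p)) (sign-square (toℕ j₀))
                 (trans (sign-exchange a j₀ (punchInᵢ≢i j₀ j′)) (cong (λ z → - (sgn j₀ * sgn z)) (punchOut′-punchIn j₀ j′)))) ⟩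
    sgn j₀ * sgn a * (M zero a * d)
      ≡⟨ *-assoc (sgn j₀) (sgn a) _ ⟩
    sgn j₀ * cofactor (suc k) M a
      ∎

det-sparseRow : ∀ k (M : Mat (suc k)) (i₀ j₀ : Fin (suc k)) → (∀ j → j ≢ j₀ → M i₀ j ≡ 0ℤ) →
  det (suc k) M ≡ sgn i₀ * (sgn j₀ * (M i₀ j₀ * det k (minor i₀ j₀ M)))
det-sparseRow k M i₀ j₀ sparse = begin
  det (suc k) M                                    ≡⟨ sym (sign-cancel (toℕ i₀) _) ⟩
  sgn i₀ * (sgn i₀ * det (suc k) M)                ≡⟨ cong (sgn i₀ *_) (sym (det-rowToFront k i₀ M)) ⟩
  sgn i₀ * det (suc k) (λ r → M (toFront i₀ r))    ≡⟨ cong (sgn i₀ *_) (sumFin-single (suc k) j₀ vanish) ⟩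
  sgn i₀ * (sgn j₀ * (M i₀ j₀ * det k (minor i₀ j₀ M))) ∎
  where
  open ≡-Reasoning
  vanish : ∀ j → j ≢ j₀ → sgn j * (M i₀ j * det k (minor i₀ j M)) ≡ 0ℤ
  vanish j j≢j₀ rewrite sparse j j≢j₀ = *-zeroʳ (sgn j)

cofactor-zeroFirstColumn : ∀ k (N : Mat (suc k)) → (∀ r → N (suc r) zero ≡ 0ℤ) → ∀ j → j ≢ zero → cofactor k N j ≡ 0ℤ
cofactor-zeroFirstColumn k       N zeroCol zero    j≢0 = ⊥-elim (j≢0 refl)
cofactor-zeroFirstColumn (suc k) N zeroCol (suc j) _
  rewrite det-zero-column (suc k) zero (minor zero (suc j) N) zeroCol
        | *-zeroʳ (N zero (suc j))
  = *-zeroʳ (sgn (suc j))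

det-sparseColumn : ∀ k (M : Mat (suc k)) (i₀ j₀ : Fin (suc k)) → (∀ i → i ≢ i₀ → M i j₀ ≡ 0ℤ) →
  det (suc k) M ≡ sgn i₀ * (sgn j₀ * (M i₀ j₀ * det k (minor i₀ j₀ M)))
det-sparseColumn k M i₀ j₀ sparse = begin
  det (suc k) M                                         ≡⟨ sym (sign-cancel (toℕ i₀) _) ⟩
  sgn i₀ * (sgn i₀ * det (suc k) M)                     ≡⟨ cong (sgn i₀ *_) (sym (sign-cancel (toℕ j₀) _)) ⟩
  sgn i₀ * (sgn j₀ * (sgn j₀ * (sgn i₀ * det (suc k) M))) ≡⟨ cong (λ t → sgn i₀ * (sgn j₀ * t)) (sym moved) ⟩
  sgn i₀ * (sgn j₀ * det (suc k) N)                     ≡⟨ cong (λ t → sgn i₀ * (sgn j₀ * t)) expandN ⟩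
  sgn i₀ * (sgn j₀ * (M i₀ j₀ * det k (minor i₀ j₀ M))) ∎
  where
  open ≡-Reasoning
  -- bring row i₀ and column j₀ to the front; the first column is then zero below the corner
  N : Mat (suc k)
  N r c = M (toFront i₀ r) (toFront j₀ c)
  moved : det (suc k) N ≡ sgn j₀ * (sgn i₀ * det (suc k) M)
  moved = trans (det-colToFront k j₀ (λ r → M (toFront i₀ r))) (cong (sgn j₀ *_) (det-rowToFront k i₀ M))
  expandN : det (suc k) N ≡ M i₀ j₀ * det k (minor i₀ j₀ M)
  expandN = trans (sumFin-single (suc k) zero (cofactor-zeroFirstColumn k N (λ r → sparse (punchIn i₀ r) (punchInᵢ≢i i₀ r))))
                  (*-identityˡ _)

∣signed-product∣≤1 : ∀ i j a d → ∣ a ∣ ℕ.≤ 1 → ∣ d ∣ ℕ.≤ 1 → ∣ sign i * (sign j * (a * d)) ∣ ℕ.≤ 1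
∣signed-product∣≤1 i j a d ∣a∣≤1 ∣d∣≤1
  rewrite ∣sign*∣ i (sign j * (a * d)) | ∣sign*∣ j (a * d) | abs-* a d = ℕP.*-mono-≤ ∣a∣≤1 ∣d∣≤1

det-bound-sparseRow : ∀ k (M : Mat (suc k)) i₀ j₀ → (∀ j → j ≢ j₀ → M i₀ j ≡ 0ℤ) →
  ∣ M i₀ j₀ ∣ ℕ.≤ 1 → ∣ det k (minor i₀ j₀ M) ∣ ℕ.≤ 1 → ∣ det (suc k) M ∣ ℕ.≤ 1
det-bound-sparseRow k M i₀ j₀ sparse ∣corner∣≤1 ∣minor∣≤1
  rewrite det-sparseRow k M i₀ j₀ sparse = ∣signed-product∣≤1 (toℕ i₀) (toℕ j₀) (M i₀ j₀) (det k (minor i₀ j₀ M)) ∣corner∣≤1 ∣minor∣≤1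

det-bound-sparseColumn : ∀ k (M : Mat (suc k)) i₀ j₀ → (∀ i → i ≢ i₀ → M i j₀ ≡ 0ℤ) →
  ∣ M i₀ j₀ ∣ ℕ.≤ 1 → ∣ det k (minor i₀ j₀ M) ∣ ℕ.≤ 1 → ∣ det (suc k) M ∣ ℕ.≤ 1
det-bound-sparseColumn k M i₀ j₀ sparse ∣corner∣≤1 ∣minor∣≤1
  rewrite det-sparseColumn k M i₀ j₀ sparse = ∣signed-product∣≤1 (toℕ i₀) (toℕ j₀) (M i₀ j₀) (det k (minor i₀ j₀ M)) ∣corner∣≤1 ∣minor∣≤1

leastWitness : ∀ {P : ℕ → Set} → (∀ m → Dec (P m)) → ∀ {n} → P n →
               Σ ℕ λ m → P m × (∀ m′ → m′ < m → ¬ P m′)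
leastWitness {P} P? {n} Pn = search 0 n refl (λ _ ())
  where
  search : ∀ m d → m ℕ.+ d ≡ n → (∀ m′ → m′ < m → ¬ P m′) → Σ ℕ λ m → P m × (∀ m′ → m′ < m → ¬ P m′)
  search m d       m+d≡n below with P? m
  ... | yes Pm = m , Pm , below
  search m zero    m+0≡n below | no ¬Pm = ⊥-elim (¬Pm (subst P (sym (trans (sym (ℕP.+-identityʳ m)) m+0≡n)) Pn))
  search m (suc d) m+d≡n below | no ¬Pm = search (suc m) d (trans (sym (ℕP.+-suc m d)) m+d≡n) below′
    where
    below′ : ∀ m′ → m′ < suc m → ¬ P m′
    below′ m′ m′<1+m with ℕP.m<1+n⇒m<n∨m≡n m′<1+m
    ... | inj₁ m′<m = below m′ m′<m
    ... | inj₂ refl = ¬Pm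

adj-sym : ∀ {n} (G : SimpleGraph n) {x y} → Adj G x y → Adj G y x
adj-sym G {x} {y} x~y = trans (symm G y x) x~y

adj-irrefl : ∀ {n} (G : SimpleGraph n) {x y} → Adj G x y → x ≢ y
adj-irrefl G {x} x~y refl with trans (sym (loopless G x)) x~y
... | ()

-- An infinite walk v₀ v₁ v₂ … in a finite graph that never immediately
-- returns to the vertex it came from contains a cycle: cut it at the first
-- vertex that repeats an earlier one.
module NonBacktrackingWalk {n} (G : SimpleGraph n) (v : ℕ → Fin n)
  (step : ∀ t → Adj G (v t) (v (suc t)))
  (nonBacktracking : ∀ t → v (suc (suc t)) ≢ v t) where

  Revisit : ℕ → Set
  Revisit j = Σ (Fin j) λ i → v (toℕ i) ≡ v j

  someRevisit : Σ ℕ Revisit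
  someRevisit with pigeonhole (ℕP.n<1+n n) (λ (t : Fin (suc n)) → v (toℕ t))
  ... | a , b , a<b , same = toℕ b , fromℕ< a<b , trans (cong v (toℕ-fromℕ< a<b)) same

  firstRevisit : Σ ℕ λ j → Revisit j × (∀ j′ → j′ < j → ¬ Revisit j′)
  firstRevisit = leastWitness (λ j → any? (λ i → v (toℕ i) ≟ᶠ v j)) (proj₂ someRevisit)

  cycle : Cycle G
  cycle with firstRevisit
  ... | j , (i , vi≡vj) , first with ℕP.m≤n⇒∃[o]m+o≡n (ℕP.<⇒≤ (toℕ<n i))
  ...   | L , i+L≡j = closeUp L i+L≡j
    where
    i′ : ℕ
    i′ = toℕ i
    distinct : ∀ a b → a < b → b < j → v a ≢ v b
    distinct a b a<b b<j va≡vb = first b b<j (fromℕ< a<b , trans (cong v (toℕ-fromℕ< a<b)) va≡vb)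
    closeUp : ∀ L → i′ ℕ.+ L ≡ j → Cycle G
    closeUp zero i+0≡j = ⊥-elim (ℕP.<-irrefl (trans (sym (ℕP.+-identityʳ i′)) i+0≡j) (toℕ<n i))
    -- a closed walk of length 1 is a loop and one of length 2 backtracks
    closeUp (suc zero) i+1≡j =
      ⊥-elim (adj-irrefl G (step i′) (trans vi≡vj (cong v (sym (trans (ℕP.+-comm 1 i′) i+1≡j)))))
    closeUp (suc (suc zero)) i+2≡j =
      ⊥-elim (nonBacktracking i′ (trans (cong v (trans (ℕP.+-comm 2 i′) i+2≡j)) (sym vi≡vj)))
    closeUp (suc (suc (suc len))) i+L≡j = record
      { len = len ; vert = walkSegment ; inj = segment-injective ; path = path′ ; close = close′ }
      where
      walkSegment : Fin (suc (suc (suc len))) → Fin n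
      walkSegment t = v (i′ ℕ.+ toℕ t)
      inside : ∀ (t : Fin (suc (suc (suc len)))) → i′ ℕ.+ toℕ t < j
      inside t = subst (i′ ℕ.+ toℕ t <_) i+L≡j (ℕP.+-monoʳ-< i′ (toℕ<n t))
      segment-injective : ∀ {a b} → walkSegment a ≡ walkSegment b → a ≡ b
      segment-injective {a} {b} same with ℕP.<-cmp (toℕ a) (toℕ b)
      ... | tri< a<b _ _ = ⊥-elim (distinct _ _ (ℕP.+-monoʳ-< i′ a<b) (inside b) same)
      ... | tri≈ _ a≡b _ = toℕ-injective a≡b
      ... | tri> _ _ b<a = ⊥-elim (distinct _ _ (ℕP.+-monoʳ-< i′ b<a) (inside a) (sym same))
      path′ : ∀ (t : Fin (suc (suc len))) → Adj G (walkSegment (inject₁ t)) (walkSegment (suc t))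
      path′ t = subst₂ (λ a b → Adj G (v a) (v b)) (cong (i′ ℕ.+_) (sym (toℕ-inject₁ t))) (sym (ℕP.+-suc i′ (toℕ t)))
                       (step (i′ ℕ.+ toℕ t))
      close′ : Adj G (walkSegment (fromℕ (suc (suc len)))) (walkSegment zero)
      close′ = subst₂ (λ a b → Adj G (v a) b) (cong (i′ ℕ.+_) (sym (toℕ-fromℕ (suc (suc len)))))
                      (trans (cong v (trans (sym (ℕP.+-suc i′ (suc (suc len)))) i+L≡j))
                             (trans (sym vi≡vj) (cong v (sym (ℕP.+-identityʳ i′)))))
                      (step (i′ ℕ.+ suc (suc len)))

submatrix : ∀ {n k} → Mat n → (Fin k → Fin n) → (Fin k → Fin n) → Mat k
submatrix M ρ γ i j = M (ρ i) (γ j)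

TotallyUnimodular : ∀ {n} → Mat n → Set
TotallyUnimodular {n} M = ∀ k (ρ γ : Fin k → Fin n) → Injective _≡_ _≡_ ρ → Injective _≡_ _≡_ γ →
                          ∣ det k (submatrix M ρ γ) ∣ ℕ.≤ 1

TU-det : ∀ {n} (M : Mat n) → TotallyUnimodular M → ∣ det n M ∣ ℕ.≤ 1
TU-det {n} M tu = tu n (λ i → i) (λ i → i) (λ e → e) (λ e → e)

injective-punchIn : ∀ {k n} (ρ : Fin (suc k) → Fin n) → Injective _≡_ _≡_ ρ → ∀ i →
                    Injective _≡_ _≡_ (ρ ∘ punchIn i)
injective-punchIn ρ ρ-inj i same = punchIn-injective i _ _ (ρ-inj same)

select : ∀ {P : Set} → Dec P → ℤ → ℤ → ℤ
select (yes _) a b = a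
select (no _)  a b = b

replaceRow : ∀ {n} → Fin n → (Fin n → ℤ) → Mat n → Mat n
replaceRow i f M r c = select (r ≟ᶠ i) (f c) (M r c)

replaceRow-here : ∀ {n} (i : Fin n) f M c → replaceRow i f M i c ≡ f c
replaceRow-here i f M c with i ≟ᶠ i
... | yes _  = refl
... | no i≢i = ⊥-elim (i≢i refl)

replaceRow-there : ∀ {n} {i r : Fin n} f M c → r ≢ i → replaceRow i f M r c ≡ M r c
replaceRow-there {i = i} {r} f M c r≢i with r ≟ᶠ i
... | yes r≡i = ⊥-elim (r≢i r≡i)
... | no _    = refl

unit : ∀ {n} → Fin n → Fin n → ℤ
unit j c = select (c ≟ᶠ j) (+ 1) (+ 0)

unit-there : ∀ {n} {j c : Fin n} → c ≢ j → unit j c ≡ + 0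
unit-there {j = j} {c} c≢j with c ≟ᶠ j
... | yes c≡j = ⊥-elim (c≢j c≡j)
... | no _    = refl

∣unit∣≤1 : ∀ {n} (j c : Fin n) → ∣ unit j c ∣ ℕ.≤ 1
∣unit∣≤1 j c with c ≟ᶠ j
... | yes _ = s≤s z≤n
... | no _  = z≤n

unit-sparse : ∀ {k n} (j : Fin n) (γ : Fin (suc k) → Fin n) → Injective _≡_ _≡_ γ →
              Σ (Fin (suc k)) λ c₀ → ∀ c → c ≢ c₀ → unit j (γ c) ≡ + 0
unit-sparse j γ γ-inj with any? (λ c → γ c ≟ᶠ j)
... | yes (c₀ , γc₀≡j) = c₀ , λ c c≢c₀ → unit-there (λ γc≡j → c≢c₀ (γ-inj (trans γc≡j (sym γc₀≡j))))
... | no  j∉γ          = zero , λ c _ → unit-there (λ γc≡j → j∉γ (c , γc≡j))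

-- Replacing a row of a totally unimodular matrix by a unit vector keeps it
-- totally unimodular: a submatrix through that row is expanded along it.
TU-replaceRow-unit : ∀ {n} (M : Mat n) (i j : Fin n) → TotallyUnimodular M →
                     TotallyUnimodular (replaceRow i (unit j) M)
TU-replaceRow-unit M i j tu zero    ρ γ ρ-inj γ-inj = s≤s z≤n
TU-replaceRow-unit M i j tu (suc k) ρ γ ρ-inj γ-inj with any? (λ r → ρ r ≟ᶠ i)
... | no i∉ρ =
  subst (λ d → ∣ d ∣ ℕ.≤ 1)
        (det-cong (suc k) (λ r c → sym (replaceRow-there (unit j) M (γ c) (λ ρr≡i → i∉ρ (r , ρr≡i)))))
        (tu (suc k) ρ γ ρ-inj γ-inj)
... | yes (r₀ , ρr₀≡i) =
  det-bound-sparseRow k N r₀ c₀ (λ c c≢c₀ → trans (rowᵣ₀ c) (sparse c c≢c₀))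
    (subst (λ x → ∣ x ∣ ℕ.≤ 1) (sym (rowᵣ₀ c₀)) (∣unit∣≤1 j (γ c₀)))
    (subst (λ d → ∣ d ∣ ℕ.≤ 1) (det-cong k otherRows)
           (tu k (ρ ∘ punchIn r₀) (γ ∘ punchIn c₀) (injective-punchIn ρ ρ-inj r₀) (injective-punchIn γ γ-inj c₀)))
  where
  N : Mat (suc k)
  N = submatrix (replaceRow i (unit j) M) ρ γ
  c₀ : Fin (suc k)
  c₀ = proj₁ (unit-sparse j γ γ-inj)
  sparse : ∀ c → c ≢ c₀ → unit j (γ c) ≡ + 0
  sparse = proj₂ (unit-sparse j γ γ-inj)
  rowᵣ₀ : ∀ c → N r₀ c ≡ unit j (γ c)
  rowᵣ₀ c rewrite ρr₀≡i = replaceRow-here i (unit j) M (γ c)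
  otherRows : ∀ r c → submatrix M (ρ ∘ punchIn r₀) (γ ∘ punchIn c₀) r c ≡ minor r₀ c₀ N r c
  otherRows r c = sym (replaceRow-there (unit j) M _ (λ same → punchInᵢ≢i r₀ r (ρ-inj (trans same (sym ρr₀≡i)))))

adj? : ∀ {n} (G : SimpleGraph n) x y → Dec (Adj G x y)
adj? G x y = adj G x y BoolP.≟ true

adjMatrix-nonadjacent : ∀ {n} (G : SimpleGraph n) {x y} → ¬ Adj G x y → adjMatrix G x y ≡ + 0
adjMatrix-nonadjacent G {x} {y} ¬x~y with adj G x y
... | true  = ⊥-elim (¬x~y refl)
... | false = refl

∣adjMatrix∣≤1 : ∀ {n} (G : SimpleGraph n) x y → ∣ adjMatrix G x y ∣ ℕ.≤ 1
∣adjMatrix∣≤1 G x y with adj G x y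
... | true  = s≤s z≤n
... | false = z≤n

TwoPoints : ∀ {k} → (Fin k → Set) → Set
TwoPoints {k} P = Σ (Fin k) λ c → Σ (Fin k) λ c′ → c ≢ c′ × P c × P c′

atMostOne⊎two : ∀ {k} {P : Fin (suc k) → Set} → Decidable P →
  (Σ (Fin (suc k)) λ c₀ → ∀ c → c ≢ c₀ → ¬ P c) ⊎ TwoPoints P
atMostOne⊎two P? with any? P?
... | no none = inj₁ (zero , λ c _ Pc → none (c , Pc))
... | yes (c , Pc) with any? (λ c′ → P? c′ ×-dec ¬? (c′ ≟ᶠ c))
...   | yes (c′ , Pc′ , c′≢c) = inj₂ (c , c′ , (λ c≡c′ → c′≢c (sym c≡c′)) , Pc , Pc′)
...   | no  noOther          = inj₁ (c , λ c′ c′≢c Pc′ → noOther (c′ , Pc′ , c′≢c))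

avoiding : ∀ {k} {P : Fin k → Set} (x : Fin k) → TwoPoints P → Σ (Fin k) λ c → c ≢ x × P c
avoiding x (c , c′ , c≢c′ , Pc , Pc′) with c ≟ᶠ x
... | yes refl = c′ , (λ c′≡x → c≢c′ (sym c′≡x)) , Pc′
... | no  c≢x  = c , c≢x , Pc

some⊎all : ∀ {k} {A B : Fin k → Set} → (∀ i → A i ⊎ B i) → Σ (Fin k) A ⊎ (∀ i → B i)
some⊎all {zero}  choice = inj₂ λ ()
some⊎all {suc k} choice with choice zero | some⊎all (choice ∘ suc)
... | inj₁ a | _            = inj₁ (zero , a)
... | inj₂ b | inj₁ (i , a) = inj₁ (suc i , a)
... | inj₂ b | inj₂ bs      = inj₂ λ { zero → b ; (suc i) → bs i }

-- Consider the bipartite graph joining row r to column c when ρ r ~ γ c in F.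
-- If every row and every column has two neighbours there, walk row, column,
-- row, … never returning to the previous row or column; since ρ and γ are
-- injective this projects to a non-backtracking walk in F, so F has a cycle.
module AlternatingWalk {n k} (F : SimpleGraph n) (ρ γ : Fin k → Fin n)
  (ρ-inj : Injective _≡_ _≡_ ρ) (γ-inj : Injective _≡_ _≡_ γ)
  (rowsTwo : ∀ r → TwoPoints (λ c → Adj F (ρ r) (γ c)))
  (columnsTwo : ∀ c → TwoPoints (λ r → Adj F (ρ r) (γ c))) where

  record Position : Set where
    field
      row col : Fin k
      linked  : Adj F (ρ row) (γ col)
  open Position

  nextRow : (p : Position) → Σ (Fin k) λ r → r ≢ row p × Adj F (ρ r) (γ (col p))
  nextRow p = avoiding (row p) (columnsTwo (col p))

  nextCol : (p : Position) → Σ (Fin k) λ c → c ≢ col p × Adj F (ρ (proj₁ (nextRow p))) (γ c)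
  nextCol p = avoiding (col p) (rowsTwo (proj₁ (nextRow p)))

  next : Position → Position
  next p = record { row = proj₁ (nextRow p) ; col = proj₁ (nextCol p) ; linked = proj₂ (proj₂ (nextCol p)) }

  vertexAt : ℕ → Position → Fin n
  vertexAt zero          p = ρ (row p)
  vertexAt (suc zero)    p = γ (col p)
  vertexAt (suc (suc t)) p = vertexAt t (next p)

  vertexAt-step : ∀ t p → Adj F (vertexAt t p) (vertexAt (suc t) p)
  vertexAt-step zero          p = linked p
  vertexAt-step (suc zero)    p = adj-sym F (proj₂ (proj₂ (nextRow p)))
  vertexAt-step (suc (suc t)) p = vertexAt-step t (next p)

  vertexAt-nonBacktracking : ∀ t p → vertexAt (suc (suc t)) p ≢ vertexAt t p
  vertexAt-nonBacktracking zero          p = proj₁ (proj₂ (nextRow p)) ∘ ρ-inj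
  vertexAt-nonBacktracking (suc zero)    p = proj₁ (proj₂ (nextCol p)) ∘ γ-inj
  vertexAt-nonBacktracking (suc (suc t)) p = vertexAt-nonBacktracking t (next p)

  cycle : Fin k → Cycle F
  cycle r₀ = NonBacktrackingWalk.cycle F (λ t → vertexAt t start) (λ t → vertexAt-step t start)
                                        (λ t → vertexAt-nonBacktracking t start)
    where
    start : Position
    start = record { row = r₀ ; col = proj₁ (rowsTwo r₀) ; linked = proj₁ (proj₂ (proj₂ (proj₂ (rowsTwo r₀)))) }

-- The adjacency matrix of an acyclic graph is totally unimodular: a submatrix
-- either has a row or a column with at most one nonzero entry, along which it
-- is expanded, or the alternating walk above yields a cycle.
forest-TU : ∀ {n} (F : SimpleGraph n) → ¬ Cycle F → TotallyUnimodular (adjMatrix F)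
forest-TU F acyclic zero    ρ γ ρ-inj γ-inj = s≤s z≤n
forest-TU F acyclic (suc k) ρ γ ρ-inj γ-inj =
  classify (some⊎all (λ r → atMostOne⊎two (λ c → adj? F (ρ r) (γ c))))
           (some⊎all (λ c → atMostOne⊎two (λ r → adj? F (ρ r) (γ c))))
  where
  N : Mat (suc k)
  N = submatrix (adjMatrix F) ρ γ
  minor-bound : ∀ r₀ c₀ → ∣ det k (minor r₀ c₀ N) ∣ ℕ.≤ 1
  minor-bound r₀ c₀ = forest-TU F acyclic k (ρ ∘ punchIn r₀) (γ ∘ punchIn c₀)
                                (injective-punchIn ρ ρ-inj r₀) (injective-punchIn γ γ-inj c₀)
  SparseRow SparseColumn : Fin (suc k) → Set
  SparseRow r    = Σ (Fin (suc k)) λ c₀ → ∀ c → c ≢ c₀ → ¬ Adj F (ρ r) (γ c)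
  SparseColumn c = Σ (Fin (suc k)) λ r₀ → ∀ r → r ≢ r₀ → ¬ Adj F (ρ r) (γ c)
  classify : Σ (Fin (suc k)) SparseRow ⊎ (∀ r → TwoPoints (λ c → Adj F (ρ r) (γ c))) →
             Σ (Fin (suc k)) SparseColumn ⊎ (∀ c → TwoPoints (λ r → Adj F (ρ r) (γ c))) →
             ∣ det (suc k) N ∣ ℕ.≤ 1
  classify (inj₁ (r₀ , c₀ , sparse)) _ =
    det-bound-sparseRow k N r₀ c₀ (λ c c≢c₀ → adjMatrix-nonadjacent F (sparse c c≢c₀))
                        (∣adjMatrix∣≤1 F _ _) (minor-bound r₀ c₀)
  classify (inj₂ rowsTwo) (inj₁ (c₀ , r₀ , sparse)) =
    det-bound-sparseColumn k N r₀ c₀ (λ r r≢r₀ → adjMatrix-nonadjacent F (sparse r r≢r₀))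
                           (∣adjMatrix∣≤1 F _ _) (minor-bound r₀ c₀)
  classify (inj₂ rowsTwo) (inj₂ columnsTwo) =
    ⊥-elim (acyclic (AlternatingWalk.cycle F ρ γ ρ-inj γ-inj rowsTwo columnsTwo zero))

cycleEdge-adj : ∀ {n} {G : SimpleGraph n} (C : Cycle G) {x y} → CycleEdge C x y → Adj G x y
cycleEdge-adj {G = G} C (inj₁ (i , inj₁ (refl , refl))) = path C i
cycleEdge-adj {G = G} C (inj₁ (i , inj₂ (refl , refl))) = adj-sym G (path C i)
cycleEdge-adj {G = G} C (inj₂ (inj₁ (refl , refl)))     = close C
cycleEdge-adj {G = G} C (inj₂ (inj₂ (refl , refl)))     = adj-sym G (close C)

SamePair : ∀ {n} → Fin n → Fin n → Fin n → Fin n → Set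
SamePair u v x y = (x ≡ u × y ≡ v) ⊎ (x ≡ v × y ≡ u)

samePair? : ∀ {n} (u v x y : Fin n) → Dec (SamePair u v x y)
samePair? u v x y = ((x ≟ᶠ u) ×-dec (y ≟ᶠ v)) ⊎-dec ((x ≟ᶠ v) ×-dec (y ≟ᶠ u))

samePair-sym : ∀ {n} {u v x y : Fin n} → SamePair u v x y → SamePair u v y x
samePair-sym (inj₁ (x≡u , y≡v)) = inj₂ (y≡v , x≡u)
samePair-sym (inj₂ (x≡v , y≡u)) = inj₁ (y≡u , x≡v)

samePair-partner : ∀ {n} {u v x y c : Fin n} → x ≢ y → SamePair u v x y → SamePair u v x c → c ≡ y
samePair-partner x≢y (inj₁ (refl , refl)) (inj₁ (_ , c≡v))     = c≡v
samePair-partner x≢y (inj₁ (refl , refl)) (inj₂ (refl , _))    = ⊥-elim (x≢y refl)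
samePair-partner x≢y (inj₂ (refl , refl)) (inj₁ (refl , _))    = ⊥-elim (x≢y refl)
samePair-partner x≢y (inj₂ (refl , refl)) (inj₂ (_ , c≡u))     = c≡u

removeIf : ∀ {P : Set} → Dec P → Bool → Bool
removeIf (yes _) b = false
removeIf (no _)  b = b

deleteEdge : ∀ {n} → SimpleGraph n → Fin n → Fin n → SimpleGraph n
deleteEdge G u v = record
  { adj      = λ x y → removeIf (samePair? u v x y) (adj G x y)
  ; symm     = λ x y → symmetric x y (samePair? u v x y) (samePair? u v y x)
  ; loopless = λ x → irreflexive x (samePair? u v x x) }
  where
  symmetric : ∀ x y (d : Dec (SamePair u v x y)) (d′ : Dec (SamePair u v y x)) →
              removeIf d (adj G x y) ≡ removeIf d′ (adj G y x)
  symmetric x y (yes _)  (yes _)   = refl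
  symmetric x y (no _)   (no _)    = symm G x y
  symmetric x y (yes p)  (no ¬p′)  = ⊥-elim (¬p′ (samePair-sym p))
  symmetric x y (no ¬p)  (yes p′)  = ⊥-elim (¬p (samePair-sym p′))
  irreflexive : ∀ x (d : Dec (SamePair u v x x)) → removeIf d (adj G x x) ≡ false
  irreflexive x (yes _) = refl
  irreflexive x (no _)  = loopless G x

deleteEdge-removed : ∀ {n} (G : SimpleGraph n) {u v x y} → SamePair u v x y → ¬ Adj (deleteEdge G u v) x y
deleteEdge-removed G {u} {v} {x} {y} p with samePair? u v x y
... | yes _ = λ ()
... | no ¬p = ⊥-elim (¬p p)

deleteEdge-kept : ∀ {n} (G : SimpleGraph n) {u v x y} → ¬ SamePair u v x y → adj (deleteEdge G u v) x y ≡ adj G x y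
deleteEdge-kept G {u} {v} {x} {y} ¬p with samePair? u v x y
... | yes p = ⊥-elim (¬p p)
... | no _  = refl

deleteEdge-⊆ : ∀ {n} (G : SimpleGraph n) {u v x y} → Adj (deleteEdge G u v) x y → Adj G x y
deleteEdge-⊆ G {u} {v} {x} {y} x~y with samePair? u v x y
... | no _ = x~y

-- Deleting an edge of the unique cycle of G leaves an acyclic graph: a cycle
-- of the smaller graph is a cycle of G, hence the unique one, hence uses the
-- deleted edge.
deleteEdge-acyclic : ∀ {n} (G : SimpleGraph n) ((C , unique) : HasUniqueCycle G) {u v} →
                     CycleEdge C u v → ¬ Cycle (deleteEdge G u v)
deleteEdge-acyclic G (C , unique) {u} {v} uv∈C D =
  deleteEdge-removed G (inj₁ (refl , refl)) (cycleEdge-adj D (proj₁ (unique D′ u v) uv∈C))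
  where
  D′ : Cycle G
  D′ = record { len = len D ; vert = vert D ; inj = inj D
              ; path = λ i → deleteEdge-⊆ G (path D i) ; close = deleteEdge-⊆ G (close D) }

det-replaceRow-+ : ∀ n (i : Fin n) (f g : Fin n → ℤ) (M : Mat n) →
  det n (replaceRow i (λ c → f c + g c) M) ≡ det n (replaceRow i f M) + det n (replaceRow i g M)
det-replaceRow-+ n i f g M =
  det-row-additive n i (replaceRow i f M) (replaceRow i g M) (replaceRow i (λ c → f c + g c) M)
    (λ r c r≢i → trans (replaceRow-there (λ c → f c + g c) M c r≢i) (sym (replaceRow-there f M c r≢i)))
    (λ r c r≢i → trans (replaceRow-there g M c r≢i) (sym (replaceRow-there f M c r≢i)))
    (λ c → trans (replaceRow-here i (λ c → f c + g c) M c) (sym (cong₂ _+_ (replaceRow-here i f M c) (replaceRow-here i g M c))))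

replaceRow-redundant : ∀ {n} (i : Fin n) f M → (∀ c → f c ≡ M i c) → ∀ r c → replaceRow i f M r c ≡ M r c
replaceRow-redundant i f M same r c with r ≟ᶠ i
... | yes refl = same c
... | no _     = refl

replaceRow-comm : ∀ {n} {u v : Fin n} → u ≢ v → ∀ f g M r c →
                  replaceRow u f (replaceRow v g M) r c ≡ replaceRow v g (replaceRow u f M) r c
replaceRow-comm {u = u} {v} u≢v f g M r c with r ≟ᶠ u | r ≟ᶠ v
... | yes refl | yes refl = ⊥-elim (u≢v refl)
... | yes refl | no _     = refl
... | no _     | yes refl = refl
... | no _     | no _     = refl

∣sum-of-four∣ : ∀ a b c d → ∣ a ∣ ℕ.≤ 1 → ∣ b ∣ ℕ.≤ 1 → ∣ c ∣ ℕ.≤ 1 → ∣ d ∣ ℕ.≤ 1 → ∣ (a + b) + (c + d) ∣ ℕ.≤ 4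
∣sum-of-four∣ a b c d ∣a∣ ∣b∣ ∣c∣ ∣d∣ =
  ℕP.≤-trans (ℤP.∣i+j∣≤∣i∣+∣j∣ (a + b) (c + d))
    (ℕP.+-mono-≤ (ℕP.≤-trans (ℤP.∣i+j∣≤∣i∣+∣j∣ a b) (ℕP.+-mono-≤ ∣a∣ ∣b∣))
                 (ℕP.≤-trans (ℤP.∣i+j∣≤∣i∣+∣j∣ c d) (ℕP.+-mono-≤ ∣c∣ ∣d∣)))

-- Let uv be an edge of G and B the adjacency matrix of G − uv.  The adjacency
-- matrix of G is B with the unit vector e_v added to row u and e_u added to
-- row v; expanding by additivity in these two rows gives four determinants of
-- B with rows replaced by unit vectors.  If G − uv is acyclic, B is totally
-- unimodular, so each of the four is 0 or ±1 and |det G| ≤ 4.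
module EdgeDecomposition {n} (G : SimpleGraph n) {u v : Fin n} (u≢v : u ≢ v) (u~v : Adj G u v) where

  B : Mat n
  B = adjMatrix (deleteEdge G u v)

  endpointRow : ∀ {x y} → SamePair u v x y → x ≢ y → Adj G x y → ∀ c → adjMatrix G x c ≡ B x c + unit y c
  endpointRow {x} {y} p x≢y x~y c with c ≟ᶠ y
  ... | yes refl = trans (cong boolToℤ x~y) (cong (_+ + 1) (sym (adjMatrix-nonadjacent (deleteEdge G u v) (deleteEdge-removed G p))))
  ... | no c≢y   = trans (cong boolToℤ (sym (deleteEdge-kept G λ q → c≢y (samePair-partner x≢y p q))))
                         (sym (ℤP.+-identityʳ _))

  otherRow : ∀ {r} → r ≢ u → r ≢ v → ∀ c → adjMatrix G r c ≡ B r c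
  otherRow r≢u r≢v c = cong boolToℤ (sym (deleteEdge-kept G λ { (inj₁ (r≡u , _)) → r≢u r≡u ; (inj₂ (r≡v , _)) → r≢v r≡v }))

  Bᵤ+eᵥ Bᵥ+eᵤ : Fin n → ℤ
  Bᵤ+eᵥ c = B u c + unit v c
  Bᵥ+eᵤ c = B v c + unit u c

  decomposed : ∀ r c → adjMatrix G r c ≡ replaceRow u Bᵤ+eᵥ (replaceRow v Bᵥ+eᵤ B) r c
  decomposed r c = byRow (r ≟ᶠ u) (r ≟ᶠ v)
    where
    byRow : Dec (r ≡ u) → Dec (r ≡ v) → adjMatrix G r c ≡ replaceRow u Bᵤ+eᵥ (replaceRow v Bᵥ+eᵤ B) r c
    byRow (yes refl) _ =
      trans (endpointRow (inj₁ (refl , refl)) u≢v u~v c) (sym (replaceRow-here u Bᵤ+eᵥ (replaceRow v Bᵥ+eᵤ B) c))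
    byRow (no r≢u) (yes refl) =
      trans (endpointRow (inj₂ (refl , refl)) (λ v≡u → u≢v (sym v≡u)) (adj-sym G u~v) c)
            (sym (trans (replaceRow-there Bᵤ+eᵥ (replaceRow v Bᵥ+eᵤ B) c r≢u) (replaceRow-here v Bᵥ+eᵤ B c)))
    byRow (no r≢u) (no r≢v) =
      trans (otherRow r≢u r≢v c)
            (sym (trans (replaceRow-there Bᵤ+eᵥ (replaceRow v Bᵥ+eᵤ B) c r≢u) (replaceRow-there Bᵥ+eᵤ B c r≢v)))

  Bᵥ Bᵤ Bᵤᵥ : Mat n
  Bᵥ  = replaceRow v (unit u) B
  Bᵤ  = replaceRow u (unit v) B
  Bᵤᵥ = replaceRow v (unit u) Bᵤ

  det-decomposed : det n (adjMatrix G) ≡ (det n B + det n Bᵥ) + (det n Bᵤ + det n Bᵤᵥ)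
  det-decomposed = begin
    det n (adjMatrix G)
      ≡⟨ det-cong n decomposed ⟩
    det n (replaceRow u Bᵤ+eᵥ (replaceRow v Bᵥ+eᵤ B))
      ≡⟨ det-replaceRow-+ n u (B u) (unit v) (replaceRow v Bᵥ+eᵤ B) ⟩
    det n (replaceRow u (B u) (replaceRow v Bᵥ+eᵤ B)) + det n (replaceRow u (unit v) (replaceRow v Bᵥ+eᵤ B))
      ≡⟨ cong₂ _+_ (det-cong n (replaceRow-redundant u (B u) (replaceRow v Bᵥ+eᵤ B) (λ c → sym (replaceRow-there Bᵥ+eᵤ B c u≢v))))
                   (det-cong n (replaceRow-comm u≢v (unit v) Bᵥ+eᵤ B)) ⟩
    det n (replaceRow v Bᵥ+eᵤ B) + det n (replaceRow v Bᵥ+eᵤ Bᵤ)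
      ≡⟨ cong₂ _+_ (det-replaceRow-+ n v (B v) (unit u) B) (det-replaceRow-+ n v (B v) (unit u) Bᵤ) ⟩
    (det n (replaceRow v (B v) B) + det n Bᵥ) + (det n (replaceRow v (B v) Bᵤ) + det n Bᵤᵥ)
      ≡⟨ cong₂ (λ s t → (s + det n Bᵥ) + (t + det n Bᵤᵥ))
               (det-cong n (replaceRow-redundant v (B v) B (λ _ → refl)))
               (det-cong n (replaceRow-redundant v (B v) Bᵤ (λ c → sym (replaceRow-there (unit v) B c v≢u)))) ⟩
    (det n B + det n Bᵥ) + (det n Bᵤ + det n Bᵤᵥ)
      ∎
    where
    open ≡-Reasoning
    v≢u : v ≢ u
    v≢u v≡u = u≢v (sym v≡u)

  ∣det∣≤4 : ¬ Cycle (deleteEdge G u v) → ∣ det n (adjMatrix G) ∣ ℕ.≤ 4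
  ∣det∣≤4 acyclic = subst (λ d → ∣ d ∣ ℕ.≤ 4) (sym det-decomposed)
    (∣sum-of-four∣ (det n B) (det n Bᵥ) (det n Bᵤ) (det n Bᵤᵥ)
                   (TU-det B tuB) (TU-det Bᵥ (TU-replaceRow-unit B v u tuB))
                   (TU-det Bᵤ tuBᵤ) (TU-det Bᵤᵥ (TU-replaceRow-unit Bᵤ v u tuBᵤ)))
    where
    tuB : TotallyUnimodular B
    tuB = forest-TU (deleteEdge G u v) acyclic
    tuBᵤ : TotallyUnimodular Bᵤ
    tuBᵤ = TU-replaceRow-unit B u v tuB

unicyclic-det-bound : ∀ {n} (G : SimpleGraph n) → HasUniqueCycle G → ∣ detG G ∣ ℕ.≤ 4
unicyclic-det-bound G (C , unique) =
  EdgeDecomposition.∣det∣≤4 G u≢v (path C zero) (deleteEdge-acyclic G (C , unique) (inj₁ (zero , inj₁ (refl , refl))))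
  where
  u≢v : vert C (inject₁ zero) ≢ vert C (suc zero)
  u≢v same with inj C same
  ... | ()

-- Graphs given by a list of edges (pairs of vertex numbers); the loop-freeness
-- proof is found by evaluation.

listed : List (ℕ × ℕ) → ℕ → ℕ → Bool
listed []             a b = false
listed ((x , y) ∷ es) a b = ((a ≡ᵇ x) ∧ (b ≡ᵇ y)) ∨ listed es a b

listAdj : ∀ {n} → List (ℕ × ℕ) → Fin n → Fin n → Bool
listAdj es x y = listed es (toℕ x) (toℕ y) ∨ listed es (toℕ y) (toℕ x)

fromEdges : ∀ n (es : List (ℕ × ℕ)) → {True (all? (λ (x : Fin n) → listAdj es x x BoolP.≟ false))} → SimpleGraph n
fromEdges n es {loopFree} = record
  { adj      = listAdj es
  ; symm     = λ x y → BoolP.∨-comm (listed es (toℕ x) (toℕ y)) _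
  ; loopless = toWitness loopFree }

G₆ H₆ : SimpleGraph 6
G₆ = fromEdges 6 ((0 , 2) ∷ (0 , 4) ∷ (0 , 5) ∷ (1 , 3) ∷ (1 , 4) ∷ (2 , 4) ∷ (2 , 5) ∷ (3 , 4) ∷ (4 , 5) ∷ [])
H₆ = fromEdges 6 ((0 , 1) ∷ (0 , 2) ∷ (0 , 3) ∷ (1 , 2) ∷ (1 , 3) ∷ (2 , 4) ∷ (3 , 5) ∷ (4 , 5) ∷ [])

G₇ H₇ : SimpleGraph 7
G₇ = fromEdges 7 ((0 , 1) ∷ (0 , 3) ∷ (0 , 4) ∷ (0 , 6) ∷ (1 , 2) ∷ (1 , 4) ∷ (2 , 4) ∷ (2 , 5) ∷ (3 , 5) ∷ (3 , 6) ∷ (5 , 6) ∷ [])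
H₇ = fromEdges 7 ((0 , 1) ∷ (0 , 2) ∷ (0 , 3) ∷ (0 , 4) ∷ (0 , 5) ∷ (0 , 6) ∷ (1 , 5) ∷ (1 , 6) ∷ (2 , 3) ∷ (2 , 4) ∷ (3 , 4) ∷ (5 , 6) ∷ [])

det-G₆ : detG G₆ ≡ + 7
det-G₆ = refl

det-H₆ : detG H₆ ≡ - + 5
det-H₆ = refl

det-G₇ : detG G₇ ≡ + 12
det-G₇ = refl

det-H₇ : detG H₇ ≡ - + 12
det-H₇ = refl

withEdge : ∀ {n} → SimpleGraph n → SimpleGraph (suc (suc n))
withEdge {n} G = record { adj = adj′ ; symm = symm′ ; loopless = loopless′ }
  where
  adj′ : Fin (suc (suc n)) → Fin (suc (suc n)) → Bool
  adj′ zero          (suc zero)    = true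
  adj′ (suc zero)    zero          = true
  adj′ (suc (suc x)) (suc (suc y)) = adj G x y
  adj′ _             _             = false
  symm′ : ∀ x y → adj′ x y ≡ adj′ y x
  symm′ zero          zero          = refl
  symm′ zero          (suc zero)    = refl
  symm′ zero          (suc (suc y)) = refl
  symm′ (suc zero)    zero          = refl
  symm′ (suc zero)    (suc zero)    = refl
  symm′ (suc zero)    (suc (suc y)) = refl
  symm′ (suc (suc x)) zero          = refl
  symm′ (suc (suc x)) (suc zero)    = refl
  symm′ (suc (suc x)) (suc (suc y)) = symm G x y
  loopless′ : ∀ x → adj′ x x ≡ false
  loopless′ zero          = refl
  loopless′ (suc zero)    = refl
  loopless′ (suc (suc x)) = loopless G x

-- Expand along row 0 (only entry at column 1), then along the old row 1
-- (only entry at column 0).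
det-withEdge : ∀ {n} (G : SimpleGraph n) → detG (withEdge G) ≡ - detG G
det-withEdge {n} G = begin
  det (suc (suc n)) M                                     ≡⟨ det-sparseRow (suc n) M zero (suc zero) row₀ ⟩
  + 1 * (- + 1 * (+ 1 * det (suc n) (minor zero (suc zero) M)))
                                                          ≡⟨ cong (λ d → + 1 * (- + 1 * (+ 1 * d))) (det-sparseRow n (minor zero (suc zero) M) zero zero row₁) ⟩
  + 1 * (- + 1 * (+ 1 * (+ 1 * (+ 1 * (+ 1 * detG G)))))  ≡⟨ solve 1 (λ d → con (+ 1) :* (:- con (+ 1) :* (con (+ 1) :* (con (+ 1) :* (con (+ 1) :* (con (+ 1) :* d))))) := :- d) refl (detG G) ⟩
  - detG G                                                ∎
  where
  open ≡-Reasoning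
  M : Mat (suc (suc n))
  M = adjMatrix (withEdge G)
  row₀ : ∀ j → j ≢ suc zero → M zero j ≡ + 0
  row₀ zero          _   = refl
  row₀ (suc zero)    j≢1 = ⊥-elim (j≢1 refl)
  row₀ (suc (suc j)) _   = refl
  row₁ : ∀ j → j ≢ zero → minor zero (suc zero) M zero j ≡ + 0
  row₁ zero    j≢0 = ⊥-elim (j≢0 refl)
  row₁ (suc j) _   = refl

-- For every n ≥ 6 some graph has det ≥ 5 and some graph has det ≤ -5: the
-- examples on 6 and 7 vertices, extended two vertices at a time by withEdge,
-- which exchanges the two kinds.

LargeDet SmallDet ExtremeDets : ℕ → Set
LargeDet n    = Σ (SimpleGraph n) λ G → + 5 ≤ detG G
SmallDet n    = Σ (SimpleGraph n) λ H → detG H ≤ - + 5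
ExtremeDets n = LargeDet n × SmallDet n

extremeDets-withEdge : ∀ {n} → ExtremeDets n → ExtremeDets (suc (suc n))
extremeDets-withEdge ((G , large) , (H , small)) =
  (withEdge H , subst (+ 5 ≤_) (sym (det-withEdge H)) (ℤP.neg-mono-≤ small)) ,
  (withEdge G , subst (_≤ - + 5) (sym (det-withEdge G)) (ℤP.neg-mono-≤ large))

-- k + 6 as six explicit successors: vertex counts then agree syntactically,
-- so the type checker never unfolds a determinant of symbolic size.
pattern sixPlus k = suc (suc (suc (suc (suc (suc k)))))

extremeDets : ∀ k → ExtremeDets (sixPlus k)
extremeDets zero =
  (G₆ , subst (+ 5 ≤_) (sym det-G₆) (+≤+ (ℕP.m≤m+n 5 2))) ,
  (H₆ , subst (_≤ - + 5) (sym det-H₆) ℤP.≤-refl)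
extremeDets (suc zero) =
  (G₇ , subst (+ 5 ≤_) (sym det-G₇) (+≤+ (ℕP.m≤m+n 5 7))) ,
  (H₇ , subst (_≤ - + 5) (sym det-H₇) (-≤- (ℕP.m≤m+n 4 7)))
extremeDets (suc (suc k)) = extremeDets-withEdge (extremeDets k)

¬≥5 : ∀ x → ∣ x ∣ ℕ.≤ 4 → ¬ (+ 5 ≤ x)
¬≥5 (+ m)    ∣x∣≤4 (+≤+ 5≤m) = ℕP.<-irrefl refl (ℕP.≤-trans 5≤m ∣x∣≤4)
¬≥5 -[1+ m ] ∣x∣≤4 ()

¬≤-5 : ∀ x → ∣ x ∣ ℕ.≤ 4 → ¬ (x ≤ - + 5)
¬≤-5 (+ m)    ∣x∣≤4 ()
¬≤-5 -[1+ m ] ∣x∣≤4 (-≤- 4≤m) = ℕP.<-irrefl refl (ℕP.≤-trans (s≤s 4≤m) ∣x∣≤4)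

corollary2p8 : ∀ (n : ℕ) → 5 < n →
    (∀ (G : SimpleGraph n) → (∀ (G′ : SimpleGraph n) → detG G′ ≤ detG G) → ¬ HasUniqueCycle G)
    × (∀ (H : SimpleGraph n) → (∀ (H′ : SimpleGraph n) → detG H ≤ detG H′) → ¬ HasUniqueCycle H)
corollary2p8 (sixPlus k) (s≤s (s≤s (s≤s (s≤s (s≤s (s≤s z≤n)))))) = maximiser , minimiser
  where
  maximiser : ∀ G → (∀ G′ → detG G′ ≤ detG G) → ¬ HasUniqueCycle G
  maximiser G maximal unicyclic =
    let (G₀ , large) = proj₁ (extremeDets k) in
    ¬≥5 (detG G) (unicyclic-det-bound G unicyclic) (ℤP.≤-trans large (maximal G₀))
  minimiser : ∀ H → (∀ H′ → detG H ≤ detG H′) → ¬ HasUniqueCycle H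
  minimiser H minimal unicyclic =
    let (H₀ , small) = proj₂ (extremeDets k) in
    ¬≤-5 (detG H) (unicyclic-det-bound H unicyclic) (ℤP.≤-trans (minimal H₀) small)
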